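{- Let $B\ge 3$ be odd. Every Gaussian $B$-happy number is an element of $1+(1+i)\mathbb{Z}[i]$. In particular, if $D\in\mathbb{Z}[i]\setminus\{0\}$ and there is a $D$-consecutive sequence of at least two Gaussian $B$-happy numbers, then $D\in(1+i)\mathbb{Z}[i]$.
   Context: Fix an integer $B\ge 2$. Every nonzero Gaussian integer $a+bi$ is written uniquely as $a+bi=\sum_{j=0}^n (a_j+b_ji)B^j$ with $a_j,b_j\in\mathbb{Z}$, $a_n,b_n$ not both $0$, and for each $j$: $|a_j|\le B-1$, $|b_j|\le B-1$, $\operatorname{sgn}(a)a_j\ge 0$, $\operatorname{sgn}(b)b_j\ge 0$. The Gaussian $B$-happy function $S_B:\mathbb{Z}[i]\to\mathbb{Z}[i]$ is defined by $S_B(0)=0$ and $S_B(a+bi)=\sum_{j=0}^n (a_j+b_ji)^2$. A Gaussian integer $z$ is Gaussian $B$-happy if $S_B^k(z)=1$ for some $k\ge1$. For $D\in\mathbb{Z}[i]\setminus\{0\}$, a $D$-consecutive sequence of length $m$ is a sequence $z,z+D,z+2D,\dots,z+(m-1)D$ with $z\in\mathbb{Z}[i]$. -}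

module Defs where

open import Data.Nat as ℕ using (ℕ; zero; suc; NonZero)
open import Data.Nat.DivMod using (_/_; _%_)
open import Data.Integer as ℤ using (ℤ; +_; ∣_∣; sign; _◃_)
open import Data.Product using (Σ; ∃; _×_; _,_)
open import Relation.Binary.PropositionalEquality using (_≡_)

record ℤ[i] : Set where
  constructor _+_i
  field
    re : ℤ
    im : ℤ
open ℤ[i] public

infixl 6 _+ᵍ_
infixl 7 _*ᵍ_

_+ᵍ_ : ℤ[i] → ℤ[i] → ℤ[i]
(a + b i) +ᵍ (c + d i) = (a ℤ.+ c) + (b ℤ.+ d) i

_*ᵍ_ : ℤ[i] → ℤ[i] → ℤ[i]
(a + b i) *ᵍ (c + d i) = (a ℤ.* c ℤ.- b ℤ.* d) + (a ℤ.* d ℤ.+ b ℤ.* c) i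

0ᵍ 1ᵍ 1+i : ℤ[i]
0ᵍ  = (+ 0) + (+ 0) i
1ᵍ  = (+ 1) + (+ 0) i
1+i = (+ 1) + (+ 1) i

_•_ : ℕ → ℤ[i] → ℤ[i]
zero  • z = 0ᵍ
suc n • z = z +ᵍ (n • z)

_∈⟨1+i⟩ : ℤ[i] → Set
z ∈⟨1+i⟩ = ∃ λ w → z ≡ 1+i *ᵍ w

_∈1+⟨1+i⟩ : ℤ[i] → Set
z ∈1+⟨1+i⟩ = ∃ λ w → z ≡ 1ᵍ +ᵍ 1+i *ᵍ w

module _ (B : ℕ) .{{_ : NonZero B}} where

  shift : ℕ → ℕ → ℕ
  shift zero    n = n
  shift (suc j) n = shift j (n / B)

  -- These are exactly the unique digits a_j of the expansion in the paper
  -- (|a_j| ≤ B-1, sgn(a) a_j ≥ 0), with a_j = 0 beyond the top digit.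
  digit : ℕ → ℤ → ℤ
  digit j a = sign a ◃ (shift j ∣ a ∣ % B)

  sumSq : ℕ → ℤ → ℤ → ℤ[i]
  sumSq zero    a b = 0ᵍ
  sumSq (suc N) a b =
    let d = digit N a + digit N b i in d *ᵍ d +ᵍ sumSq N a b

  -- Gaussian B-happy function. All digits at positions ≥ |a|+|b|+1 vanish
  -- (B ≥ 2), so summing over j < |a|+|b|+1 is the sum over j = 0..n.
  S : ℤ[i] → ℤ[i]
  S (a + b i) = sumSq (suc (∣ a ∣ ℕ.+ ∣ b ∣)) a b

  S^ : ℕ → ℤ[i] → ℤ[i]
  S^ zero    z = z
  S^ (suc k) z = S (S^ k z)

  Happy : ℤ[i] → Set
  Happy z = Σ ℕ λ k → (1 ℕ.≤ k) × (S^ k z ≡ 1ᵍ)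

{-# OPTIONS --safe #-}
module Submission where

-- The map z ↦ re z + im z mod 2 is the reduction ℤ[i] → ℤ[i]/(1+i) ≅ 𝔽₂, a ring
-- homomorphism. It sends a square to itself, and in an odd base B ≡ 1 (mod 2) a
-- number is congruent to its digit sum, so S_B(z) ≡ z (mod 1+i). Hence every
-- iterate of a happy number, in particular 1, lies in its class modulo 1+i; two
-- happy numbers z and z + D then both lie in 1 + (1+i)ℤ[i], so D ∈ (1+i)ℤ[i].

open import Defs
open import Data.Nat as ℕ using (ℕ; zero; suc; NonZero; _≤_; _<_; _∸_; s≤s; z≤n)
open import Data.Nat.Properties
  using (≤-refl; ≤-trans; ≤-reflexive; ≤-pred; ∸-monoˡ-≤; ∸-+-assoc; n≤0⇒n≡0; m≤n⇒m∸n≡0; <⇒≤;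
         m≤m+n; m≤n+m)
open import Data.Nat.DivMod using (_/_; _%_; m≡m%n+[m/n]*n; m%n<n; m/n<m; 0/n≡0)
open import Data.Nat.Divisibility using (_∣_; m%n≡0⇒n∣m)
open import Data.Integer using (ℤ; +_; _+_; _-_; -_; _*_; ∣_∣; sign; _◃_; _%ℕ_; _/ℕ_)
open import Data.Integer.Properties using (pos-+; pos-*; +-identityˡ; +-identityʳ; *-identityʳ; ◃-inverse)
open import Data.Integer.DivMod using (a≡a%ℕn+[a/ℕn]*n; n%ℕd<d)
open import Data.Integer.Tactic.RingSolver using (solve-∀)
open import Data.Sign using (Sign)
open import Data.Product using (_×_; _,_; ∃; map₂)
open import Relation.Binary.Bundles using (Setoid)
open import Relation.Binary.Structures using (IsEquivalence)
import Relation.Binary.Reasoning.Setoid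
open import Relation.Binary.PropositionalEquality using (_≡_; refl; sym; trans; cong; cong₂; subst)
open import Relation.Nullary using (¬_; contradiction)
open import Function using (_∘_)

infix 4 _≡₂_

data _≡₂_ (x y : ℤ) : Set where
  _,_ : (k : ℤ) → x ≡ y + k * + 2 → x ≡₂ y

≡₂-refl : ∀ {x} → x ≡₂ x
≡₂-refl {x} = + 0 , sym (+-identityʳ x)

≡₂-sym : ∀ {x y} → x ≡₂ y → y ≡₂ x
≡₂-sym {y = y} (k , refl) = - k , identity y k
  where
  identity : ∀ y k → y ≡ y + k * + 2 + - k * + 2
  identity = solve-∀

≡₂-trans : ∀ {x y z} → x ≡₂ y → y ≡₂ z → x ≡₂ z
≡₂-trans {z = z} (k , refl) (l , refl) = l + k , identity z k l
  where
  identity : ∀ z k l → z + l * + 2 + k * + 2 ≡ z + (l + k) * + 2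
  identity = solve-∀

≡₂-isEquivalence : IsEquivalence _≡₂_
≡₂-isEquivalence = record { refl = ≡₂-refl ; sym = ≡₂-sym ; trans = ≡₂-trans }

≡₂-setoid : Setoid _ _
≡₂-setoid = record { isEquivalence = ≡₂-isEquivalence }

module ≡₂-Reasoning = Relation.Binary.Reasoning.Setoid ≡₂-setoid

+-cong-≡₂ : ∀ {x x′ y y′} → x ≡₂ x′ → y ≡₂ y′ → x + y ≡₂ x′ + y′
+-cong-≡₂ {x′ = x′} {y′ = y′} (k , refl) (l , refl) = k + l , identity x′ y′ k l
  where
  identity : ∀ x y k l → x + k * + 2 + (y + l * + 2) ≡ x + y + (k + l) * + 2
  identity = solve-∀

*-cong-≡₂ : ∀ {x x′ y y′} → x ≡₂ x′ → y ≡₂ y′ → x * y ≡₂ x′ * y′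
*-cong-≡₂ {x′ = x′} {y′ = y′} (k , refl) (l , refl) =
  x′ * l + k * y′ + k * l * + 2 , identity x′ y′ k l
  where
  identity : ∀ x y k l →
    (x + k * + 2) * (y + l * + 2) ≡ x * y + (x * l + k * y + k * l * + 2) * + 2
  identity = solve-∀

+-congˡ-≡₂ : ∀ x {y y′} → y ≡₂ y′ → x + y ≡₂ x + y′
+-congˡ-≡₂ x = +-cong-≡₂ (≡₂-refl {x})

*-congˡ-≡₂ : ∀ x {y y′} → y ≡₂ y′ → x * y ≡₂ x * y′
*-congˡ-≡₂ x = *-cong-≡₂ (≡₂-refl {x})

+-cancelˡ-≡₂ : ∀ x {y y′} → x + y ≡₂ x + y′ → y ≡₂ y′
+-cancelˡ-≡₂ x {y} {y′} (k , eq) =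
  k , trans (cancel x y) (trans (cong (_- x) eq) (cancel-+k x y′ k))
  where
  cancel : ∀ x y → y ≡ x + y - x
  cancel = solve-∀
  cancel-+k : ∀ x y k → x + y + k * + 2 - x ≡ y + k * + 2
  cancel-+k = solve-∀

≡₂-%ℕ2 : ∀ x → x ≡₂ + (x %ℕ 2)
≡₂-%ℕ2 x = x /ℕ 2 , a≡a%ℕn+[a/ℕn]*n x 2

odd⇒≡₂1 : ∀ {n} → ¬ 2 ∣ n → + n ≡₂ + 1
odd⇒≡₂1 {n} 2∤n with n % 2 in eq | m%n<n n 2
... | 0 | _ = contradiction (m%n≡0⇒n∣m n 2 eq) 2∤n
... | 1 | _ = subst (λ r → + n ≡₂ + r) eq (≡₂-%ℕ2 (+ n))
... | suc (suc _) | s≤s (s≤s ())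

*-self-≡₂ : ∀ x → x * x ≡₂ x
*-self-≡₂ x = begin
  x * x                       ≈⟨ *-cong-≡₂ x≡₂r x≡₂r ⟩
  + (x %ℕ 2) * + (x %ℕ 2)     ≡⟨ idempotent (n%ℕd<d x 2) ⟩
  + (x %ℕ 2)                  ≈⟨ ≡₂-sym x≡₂r ⟩
  x                           ∎
  where
  open ≡₂-Reasoning
  x≡₂r : x ≡₂ + (x %ℕ 2)
  x≡₂r = ≡₂-%ℕ2 x
  idempotent : ∀ {r} → r < 2 → + r * + r ≡ + r
  idempotent {0} _ = refl
  idempotent {1} _ = refl
  idempotent {suc (suc _)} (s≤s (s≤s ()))

neg-≡₂ : ∀ x → - x ≡₂ x
neg-≡₂ x = - x , identity x
  where
  identity : ∀ x → - x ≡ x + - x * + 2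
  identity = solve-∀

◃-≡₂ : ∀ s n → s ◃ n ≡₂ + n
◃-≡₂ s             zero    = ≡₂-refl
◃-≡₂ Sign.+        (suc n) = ≡₂-refl
◃-≡₂ Sign.-        (suc n) = neg-≡₂ (+ suc n)

≡₂-∣∣ : ∀ a → a ≡₂ + ∣ a ∣
≡₂-∣∣ a = subst (_≡₂ + ∣ a ∣) (◃-inverse a) (◃-≡₂ (sign a) ∣ a ∣)

re+im : ℤ[i] → ℤ
re+im z = re z + im z

re+im-+ᵍ : ∀ z w → re+im (z +ᵍ w) ≡ re+im z + re+im w
re+im-+ᵍ (a + b i) (c + d i) = identity a b c d
  where
  identity : ∀ a b c d → a + c + (b + d) ≡ a + b + (c + d)
  identity = solve-∀

re+im-*ᵍ : ∀ z w → re+im (z *ᵍ w) ≡₂ re+im z * re+im w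
re+im-*ᵍ (a + b i) (c + d i) = - (b * d) , identity a b c d
  where
  identity : ∀ a b c d →
    a * c - b * d + (a * d + b * c) ≡ (a + b) * (c + d) + - (b * d) * + 2
  identity = solve-∀

re+im-square : ∀ z → re+im (z *ᵍ z) ≡₂ re+im z
re+im-square z = ≡₂-trans (re+im-*ᵍ z z) (*-self-≡₂ (re+im z))

+ᵍ-identityˡ : ∀ z → 0ᵍ +ᵍ z ≡ z
+ᵍ-identityˡ (a + b i) = cong₂ _+_i (+-identityˡ a) (+-identityˡ b)

+ᵍ-identityʳ : ∀ z → z +ᵍ 0ᵍ ≡ z
+ᵍ-identityʳ (a + b i) = cong₂ _+_i (+-identityʳ a) (+-identityʳ b)

-- With re z + im z = re z₀ + im z₀ + 2k, the quotient is w = k + (im z − im z₀ − k) i.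
re+im-≡₂⇒≡+⟨1+i⟩ : ∀ z z₀ → re+im z ≡₂ re+im z₀ → ∃ λ w → z ≡ z₀ +ᵍ 1+i *ᵍ w
re+im-≡₂⇒≡+⟨1+i⟩ (a + b i) (a₀ + b₀ i) (k , eq) =
  k + (b - b₀ - k) i ,
  cong₂ _+_i (trans (cancel a b) (trans (cong (_- b) eq) (real-part a₀ b₀ b k)))
             (imaginary-part b₀ b k)
  where
  cancel : ∀ a b → a ≡ a + b - b
  cancel = solve-∀
  real-part : ∀ a₀ b₀ b k → a₀ + b₀ + k * + 2 - b ≡ a₀ + (+ 1 * k - + 1 * (b - b₀ - k))
  real-part = solve-∀
  imaginary-part : ∀ b₀ b k → b ≡ b₀ + (+ 1 * (b - b₀ - k) + + 1 * k)
  imaginary-part = solve-∀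

re+im≡₂1⇒∈1+⟨1+i⟩ : ∀ z → re+im z ≡₂ + 1 → z ∈1+⟨1+i⟩
re+im≡₂1⇒∈1+⟨1+i⟩ z = re+im-≡₂⇒≡+⟨1+i⟩ z 1ᵍ

re+im≡₂0⇒∈⟨1+i⟩ : ∀ z → re+im z ≡₂ + 0 → z ∈⟨1+i⟩
re+im≡₂0⇒∈⟨1+i⟩ z h = map₂ (λ eq → trans eq (+ᵍ-identityˡ _)) (re+im-≡₂⇒≡+⟨1+i⟩ z 0ᵍ h)

module _ (B : ℕ) .{{_ : NonZero B}} where

  shift-suc : ∀ j n → shift B (suc j) n ≡ shift B j n / B
  shift-suc zero    n = refl
  shift-suc (suc j) n = shift-suc j (n / B)

  digitSum : ℕ → ℕ → ℤ
  digitSum zero    n = + 0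
  digitSum (suc N) n = + (shift B N n % B) + digitSum N n

  re+im-sumSq : ∀ N a b → re+im (sumSq B N a b) ≡₂ digitSum N (∣ a ∣) + digitSum N (∣ b ∣)
  re+im-sumSq zero    a b = ≡₂-refl
  re+im-sumSq (suc N) a b = begin
    re+im (d *ᵍ d +ᵍ sumSq B N a b)           ≡⟨ re+im-+ᵍ (d *ᵍ d) _ ⟩
    re+im (d *ᵍ d) + re+im (sumSq B N a b)     ≈⟨ +-cong-≡₂ (re+im-square d) (re+im-sumSq N a b) ⟩
    x + y + (digitSum N (∣ a ∣) + digitSum N (∣ b ∣))
      ≈⟨ +-cong-≡₂ (+-cong-≡₂ (◃-≡₂ (sign a) r) (◃-≡₂ (sign b) s)) ≡₂-refl ⟩
    + r + + s + (digitSum N (∣ a ∣) + digitSum N (∣ b ∣))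
      ≡⟨ interchange (+ r) (+ s) (digitSum N (∣ a ∣)) (digitSum N (∣ b ∣)) ⟩
    digitSum (suc N) (∣ a ∣) + digitSum (suc N) (∣ b ∣) ∎
    where
    open ≡₂-Reasoning
    x y : ℤ
    x = digit B N a
    y = digit B N b
    d : ℤ[i]
    d = x + y i
    r s : ℕ
    r = shift B N ∣ a ∣ % B
    s = shift B N ∣ b ∣ % B
    interchange : ∀ r s u v → r + s + (u + v) ≡ r + u + (s + v)
    interchange = solve-∀

  module _ (1<B : 1 < B) where

    /-≤-pred : ∀ n → n / B ≤ n ∸ 1
    /-≤-pred zero    = ≤-reflexive (0/n≡0 B)
    /-≤-pred (suc n) = ≤-pred (m/n<m (suc n) B 1<B)

    shift-≤-∸ : ∀ j n → shift B j n ≤ n ∸ j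
    shift-≤-∸ zero    n = ≤-refl
    shift-≤-∸ (suc j) n = begin
      shift B j (n / B)  ≤⟨ shift-≤-∸ j (n / B) ⟩
      n / B ∸ j          ≤⟨ ∸-monoˡ-≤ j (/-≤-pred n) ⟩
      n ∸ 1 ∸ j          ≡⟨ ∸-+-assoc n 1 j ⟩
      n ∸ suc j          ∎
      where open Data.Nat.Properties.≤-Reasoning

    shift-vanishes : ∀ {N n} → n < N → shift B N n ≡ 0
    shift-vanishes {N} {n} n<N =
      n≤0⇒n≡0 (≤-trans (shift-≤-∸ N n) (≤-reflexive (m≤n⇒m∸n≡0 (<⇒≤ n<N))))

  module _ (2∤B : ¬ 2 ∣ B) where

    ≡₂-%+/ : ∀ n → + n ≡₂ + (n % B) + + (n / B)
    ≡₂-%+/ n = begin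
      + n
        ≡⟨ cong +_ (m≡m%n+[m/n]*n n B) ⟩
      + (n % B ℕ.+ n / B ℕ.* B)
        ≡⟨ trans (pos-+ (n % B) _) (cong (_+_ (+ (n % B))) (pos-* (n / B) B)) ⟩
      + (n % B) + + (n / B) * + B
        ≈⟨ +-congˡ-≡₂ (+ (n % B)) (*-congˡ-≡₂ (+ (n / B)) (odd⇒≡₂1 2∤B)) ⟩
      + (n % B) + + (n / B) * + 1
        ≡⟨ cong (_+_ (+ (n % B))) (*-identityʳ (+ (n / B))) ⟩
      + (n % B) + + (n / B)
        ∎
      where open ≡₂-Reasoning

    ≡₂-digitSum+shift : ∀ N n → + n ≡₂ digitSum N n + + shift B N n
    ≡₂-digitSum+shift zero    n = ≡₂-refl
    ≡₂-digitSum+shift (suc N) n = begin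
      + n                           ≈⟨ ≡₂-digitSum+shift N n ⟩
      digitSum N n + + m            ≈⟨ +-congˡ-≡₂ (digitSum N n) (≡₂-%+/ m) ⟩
      digitSum N n + (+ (m % B) + + (m / B))
        ≡⟨ rotate (digitSum N n) (+ (m % B)) (+ (m / B)) ⟩
      + (m % B) + digitSum N n + + (m / B)
        ≡⟨ cong (λ q → digitSum (suc N) n + + q) (sym (shift-suc N n)) ⟩
      digitSum (suc N) n + + shift B (suc N) n ∎
      where
      open ≡₂-Reasoning
      m : ℕ
      m = shift B N n
      rotate : ∀ u r q → u + (r + q) ≡ r + u + q
      rotate = solve-∀

  module _ (1<B : 1 < B) (2∤B : ¬ 2 ∣ B) where

    ≡₂-digitSum : ∀ {N n} → n < N → + n ≡₂ digitSum N n
    ≡₂-digitSum {N} {n} n<N = begin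
      + n                          ≈⟨ ≡₂-digitSum+shift 2∤B N n ⟩
      digitSum N n + + shift B N n ≡⟨ cong (λ q → digitSum N n + + q) (shift-vanishes 1<B n<N) ⟩
      digitSum N n + + 0           ≡⟨ +-identityʳ (digitSum N n) ⟩
      digitSum N n                 ∎
      where open ≡₂-Reasoning

    re+im-S : ∀ z → re+im (S B z) ≡₂ re+im z
    re+im-S (a + b i) = begin
      re+im (sumSq B N a b)                    ≈⟨ re+im-sumSq N a b ⟩
      digitSum N (∣ a ∣) + digitSum N (∣ b ∣)  ≈˘⟨ +-cong-≡₂ (≡₂-digitSum (s≤s (m≤m+n ∣ a ∣ ∣ b ∣)))
                                                              (≡₂-digitSum (s≤s (m≤n+m ∣ b ∣ ∣ a ∣))) ⟩
      + ∣ a ∣ + + ∣ b ∣                        ≈˘⟨ +-cong-≡₂ (≡₂-∣∣ a) (≡₂-∣∣ b) ⟩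
      a + b                                    ∎
      where
      open ≡₂-Reasoning
      N : ℕ
      N = suc (∣ a ∣ ℕ.+ ∣ b ∣)

    re+im-S^ : ∀ k z → re+im (S^ B k z) ≡₂ re+im z
    re+im-S^ zero    z = ≡₂-refl
    re+im-S^ (suc k) z = ≡₂-trans (re+im-S (S^ B k z)) (re+im-S^ k z)

    Happy⇒re+im≡₂1 : ∀ {z} → Happy B z → re+im z ≡₂ + 1
    Happy⇒re+im≡₂1 {z} (k , _ , S^kz≡1) =
      ≡₂-sym (subst (λ w → re+im w ≡₂ re+im z) S^kz≡1 (re+im-S^ k z))

    Happy-+⇒∈⟨1+i⟩ : ∀ {z D} → Happy B z → Happy B (z +ᵍ D) → D ∈⟨1+i⟩
    Happy-+⇒∈⟨1+i⟩ {z} {D} happy-z happy-z+D =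
      re+im≡₂0⇒∈⟨1+i⟩ D (+-cancelˡ-≡₂ (re+im z) (begin
      re+im z + re+im D  ≡˘⟨ re+im-+ᵍ z D ⟩
      re+im (z +ᵍ D)     ≈⟨ Happy⇒re+im≡₂1 happy-z+D ⟩
      + 1                ≈˘⟨ Happy⇒re+im≡₂1 happy-z ⟩
      re+im z            ≡˘⟨ +-identityʳ (re+im z) ⟩
      re+im z + + 0      ∎))
      where open ≡₂-Reasoning

theorem12 : (B : ℕ) .{{_ : NonZero B}} → 3 ≤ B → ¬ (2 ∣ B) →
    ((z : ℤ[i]) → Happy B z → z ∈1+⟨1+i⟩)
    × ((D : ℤ[i]) → ¬ (D ≡ 0ᵍ) → (z : ℤ[i]) (m : ℕ) → 2 ≤ m →
       ((t : ℕ) → t < m → Happy B (z +ᵍ (t • D))) → D ∈⟨1+i⟩)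
theorem12 B 3≤B 2∤B =
  (λ z → re+im≡₂1⇒∈1+⟨1+i⟩ z ∘ Happy⇒re+im≡₂1 B 1<B 2∤B) ,
  λ D _ z m 2≤m happy → Happy-+⇒∈⟨1+i⟩ B 1<B 2∤B
    (subst (Happy B) (+ᵍ-identityʳ z) (happy 0 (≤-trans (s≤s z≤n) 2≤m)))
    (subst (λ w → Happy B (z +ᵍ w)) (+ᵍ-identityʳ D) (happy 1 2≤m))
  where
  1<B : 1 < B
  1<B = ≤-trans (s≤s (s≤s z≤n)) 3≤B
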